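{- For all positive integers $r\ge2$, $t\ge2$ and $n$ there exists an $r$-uniform $r$-partite hypergraph $H$ with all parts of size $n$ and \[ \delta'_{r-1}(H)\ge\frac{n}{(r-1)t+1}-1 \] that has no $t$-shallow hitting edge set.
   Context: A hypergraph $H=(V,E)$ has a finite vertex set and a finite multiset of edges (subsets of $V$). It is $r$-uniform if each edge has $r$ vertices and $r$-partite with parts $V_1,\dots,V_r$ if these partition $V$ and every edge meets each $V_i$ in at most one vertex. A set $\hat e\subseteq V$ is legal if $|\hat e\cap V_i|\le1$ for all $i$. For $\hat e$ with $|\hat e|=r-1$, $N_{r-1}(\hat e)$ is the set of vertices $v$ with $\hat e\cup\{v\}$ an edge of $H$; $\delta'_{r-1}(H)$ is the minimum of $|N_{r-1}(\hat e)|$ over all legal $(r-1)$-sets $\hat e$. For $M\subseteq E$, $\deg_M(v)$ is the number of edges of $M$ containing $v$; $M$ is hitting if $\deg_M(v)\ge1$ for all $v$, and $t$-shallow if $\deg_M(v)\le t$ for all $v$. -}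

module Defs where

open import Data.Nat using (ℕ; _≤_; _*_; _+_; _∸_)
open import Data.Fin using (Fin; _≟_)
open import Data.Fin.Properties using (all?)
open import Data.List using (List; length; filter; allFin)
open import Data.List.Relation.Unary.Any using (Any; any?)
open import Data.List.Relation.Binary.Sublist.Propositional using (_⊆_)
open import Data.Product using (Σ; _×_; _,_)
open import Relation.Binary.PropositionalEquality using (_≡_; _≢_)
open import Relation.Nullary using (Dec; ¬_)
open import Relation.Nullary.Decidable using (_×-dec_; _→-dec_; ¬?)

-- Vertex set: Fin r × Fin n, part V_i = {i} × Fin n.
-- Since every edge has r vertices and meets each of the r parts in at
-- most one vertex, an edge meets every part in exactly one vertex, i.e.
-- it is a function  Fin r → Fin n  (vertex (i , e i) in part i).
-- The edge multiset is a list of such functions (repetitions allowed).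
Edge : ℕ → ℕ → Set
Edge r n = Fin r → Fin n

Hypergraph : ℕ → ℕ → Set
Hypergraph r n = List (Edge r n)

Vertex : ℕ → ℕ → Set
Vertex r n = Fin r × Fin n

_∈ₑ_ : ∀ {r n} → Vertex r n → Edge r n → Set
(i , x) ∈ₑ e = e i ≡ x

_∈ₑ?_ : ∀ {r n} (v : Vertex r n) (e : Edge r n) → Dec (v ∈ₑ e)
(i , x) ∈ₑ? e = e i ≟ x

-- A legal (r-1)-set ê is given by the part j it misses and a choice f i
-- of a vertex in each other part i ≠ j (the value f j is ignored).
-- The vertex x of part j lies in N_{r-1}(ê) iff ê ∪ {(j , x)} is an edge.
-- (Vertices of other parts can never complete ê to an edge.)
InNbhd : ∀ {r n} → Hypergraph r n → Fin r → (Fin r → Fin n) → Fin n → Set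
InNbhd H j f x = Any (λ e → ((i : Fin _) → i ≢ j → e i ≡ f i) × e j ≡ x) H

inNbhd? : ∀ {r n} (H : Hypergraph r n) j f x → Dec (InNbhd H j f x)
inNbhd? H j f x =
  any? (λ e → all? (λ i → ¬? (i ≟ j) →-dec (e i ≟ f i)) ×-dec (e j ≟ x)) H

nbhdSize : ∀ {r n} → Hypergraph r n → Fin r → (Fin r → Fin n) → ℕ
nbhdSize {n = n} H j f = length (filter (inNbhd? H j f) (allFin n))

deg : ∀ {r n} → List (Edge r n) → Vertex r n → ℕ
deg M v = length (filter (v ∈ₑ?_) M)

Hitting : ∀ {r n} → List (Edge r n) → Set
Hitting M = ∀ v → 1 ≤ deg M v

Shallow : ∀ {r n} → ℕ → List (Edge r n) → Set
Shallow t M = ∀ v → deg M v ≤ t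

-- sub-multisets of E are exactly (order-preserving) sublists of E
HasShallowHittingSet : ∀ {r n} → ℕ → Hypergraph r n → Set
HasShallowHittingSet t H = Σ (List (Edge _ _)) λ M → M ⊆ H × Hitting M × Shallow t M

-- Take r = m + 1 parts, part 0 being special, K = m t + 1, b = ⌊n / K⌋ and
-- a = m b t + 1. The edges of H are all edges e such that, whenever the vertex
-- of e in part 0 is one of the a "low" vertices 0, …, a - 1, some other vertex
-- of e is one of the b low vertices of its part. In a hitting set the a low
-- vertices of part 0 lie in pairwise distinct edges, each of which meets one
-- of the m b low vertices of the other parts; so t-shallowness would give
-- a ≤ m b t.
-- Conversely, every (r-1)-set missing part 0 extends by all n - a high
-- vertices of part 0, and every (r-1)-set missing another part extends by all
-- b low vertices of that part, which is enough for the codegree bound.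
module Submission where

open import Defs
open import Data.Nat
  using (ℕ; zero; suc; _≤_; _<_; _*_; _+_; _∸_; z≤n; s≤s; _<?_)
open import Data.Nat.Properties
open import Data.Nat.DivMod using (_/_; _%_; m≡m%n+[m/n]*n; m%n<n; m/n*n≤m; m/n≤m)
open import Data.Fin using (Fin; zero; suc; toℕ; fromℕ<; inject≤; combine; remQuot)
open import Data.Fin.Properties
  using (toℕ<n; toℕ-injective; toℕ-fromℕ<; toℕ-inject≤; injective⇒≤; remQuot-combine)
  renaming (any? to anyᶠ?)
open import Data.Vec.Functional using (Vector; updateAt) renaming ([] to []ᵛ; _∷_ to _∷ᵛ_)
open import Data.Vec.Functional.Properties using (updateAt-updates; updateAt-minimal)
open import Data.List using (List; []; _∷_; [_]; length; filter; lookup; allFin; cartesianProductWith)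
open import Data.List.Relation.Unary.Any using (Any; here; there; index)
open import Data.List.Relation.Unary.Any.Properties using (lookup-index)
import Data.List.Relation.Unary.Any as Any
import Data.List.Relation.Unary.All as All
open import Data.List.Relation.Unary.All using (All; []; _∷_)
open import Data.List.Relation.Unary.All.Properties using (all-filter; filter⁺)
open import Data.List.Membership.Propositional using (find; lose)
open import Data.List.Membership.Propositional.Properties
  using (∈-allFin; ∈-filter⁺; ∈-cartesianProductWith⁺)
open import Data.List.Relation.Binary.Sublist.Propositional.Properties
  using (All-resp-⊆; filter-⊆; length-mono-≤)
import Data.List.Relation.Binary.Sublist.Propositional.Properties as Sublist
open import Data.List.Relation.Ternary.Interleaving.Properties using (interleave-length)
import Data.List.Relation.Ternary.Interleaving.Setoid.Properties as Interleaving
open import Data.Product using (Σ; ∃-syntax; _×_; _,_)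
open import Function using (_∘_; const)
open import Relation.Binary.PropositionalEquality
  using (_≡_; refl; sym; trans; cong; subst; subst₂; _≗_; setoid; module ≡-Reasoning)
open import Relation.Nullary using (Dec; yes; no; ¬_; ¬?; contradiction)
open import Relation.Nullary.Decidable using (_→-dec_)
open import Relation.Unary using (Pred; Decidable)
open import Level using (0ℓ)

module _ {A : Set} where

  nonempty-filter⇒Any : {P : Pred A 0ℓ} (P? : Decidable P) (xs : List A) →
    0 < length (filter P? xs) → Any P xs
  nonempty-filter⇒Any P? (x ∷ xs) nonempty with P? x
  ... | yes px = here px
  ... | no _ = there (nonempty-filter⇒Any P? xs nonempty)

  -- The positions of the witnesses give an injection Fin c → Fin (length xs).
  covering⇒≤length : (g : A → ℕ) (c : ℕ) (xs : List A) →
    (∀ k → k < c → Any (λ x → g x ≡ k) xs) → c ≤ length xs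
  covering⇒≤length g c xs covers = injective⇒≤ {f = position} position-injective
    where
    witness : (k : Fin c) → Any (λ x → g x ≡ toℕ k) xs
    witness k = covers (toℕ k) (toℕ<n k)

    position : Fin c → Fin (length xs)
    position k = index (witness k)

    position-injective : ∀ {i j} → position i ≡ position j → i ≡ j
    position-injective {i} {j} same = toℕ-injective (begin
      toℕ i                        ≡⟨ lookup-index (witness i) ⟨
      g (lookup xs (position i))   ≡⟨ cong (g ∘ lookup xs) same ⟩
      g (lookup xs (position j))   ≡⟨ lookup-index (witness j) ⟩
      toℕ j                        ∎)
      where open ≡-Reasoning

  double-counting : ∀ {k} {R : A → Fin k → Set} (R? : ∀ x ℓ → Dec (R x ℓ))
    (t : ℕ) (xs : List A) →
    All (λ x → ∃[ ℓ ] R x ℓ) xs →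
    (∀ ℓ → length (filter (λ x → R? x ℓ) xs) ≤ t) →
    length xs ≤ k * t
  double-counting {zero} R? t [] [] bounded = z≤n
  double-counting {zero} R? t (x ∷ xs) ((() , _) ∷ _) bounded
  double-counting {suc k} {R} R? t xs related bounded = begin
    length xs
      ≡⟨ interleave-length (Interleaving.filter⁺ (setoid A) R₀? xs) ⟩
    length (filter R₀? xs) + length rest
      ≤⟨ +-mono-≤ (bounded zero)
                  (double-counting (λ x ℓ → R? x (suc ℓ)) t rest related′ bounded′) ⟩
    t + k * t ∎
    where
    open ≤-Reasoning
    R₀? : Decidable (λ x → R x zero)
    R₀? x = R? x zero

    rest : List A
    rest = filter (¬? ∘ R₀?) xs

    avoid-zero : ∀ {x} → (∃[ ℓ ] R x ℓ) × ¬ R x zero → ∃[ ℓ ] R x (suc ℓ)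
    avoid-zero ((zero , r) , ¬r) = contradiction r ¬r
    avoid-zero ((suc ℓ , r) , _) = ℓ , r

    related′ : All (λ x → ∃[ ℓ ] R x (suc ℓ)) rest
    related′ = All.zipWith avoid-zero (filter⁺ (¬? ∘ R₀?) related , all-filter (¬? ∘ R₀?) xs)

    bounded′ : ∀ ℓ → length (filter (λ x → R? x (suc ℓ)) rest) ≤ t
    bounded′ ℓ = ≤-trans
      (length-mono-≤ (Sublist.filter⁺ _ _ (λ { refl r → r }) (filter-⊆ (¬? ∘ R₀?) xs)))
      (bounded (suc ℓ))

interval⊆filter⇒∸≤length : ∀ {n lo hi} {Q : Pred (Fin n) 0ℓ} (Q? : Decidable Q) →
  lo ≤ hi → hi ≤ n → (∀ x → lo ≤ toℕ x → toℕ x < hi → Q x) →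
  hi ∸ lo ≤ length (filter Q? (allFin n))
interval⊆filter⇒∸≤length {n} {lo} {hi} Q? lo≤hi hi≤n interval⊆Q =
  covering⇒≤length (λ x → toℕ x ∸ lo) (hi ∸ lo) (filter Q? (allFin n)) covered
  where
  covered : ∀ k → k < hi ∸ lo → Any (λ x → toℕ x ∸ lo ≡ k) (filter Q? (allFin n))
  covered k k<hi∸lo = lose (∈-filter⁺ Q? (∈-allFin x) (interval⊆Q x lo≤x x<hi)) shifted
    where
    k+lo<hi : k + lo < hi
    k+lo<hi = m≤o∸n⇒m+n≤o (suc k) lo≤hi k<hi∸lo
    x : Fin n
    x = fromℕ< (≤-trans k+lo<hi hi≤n)
    x≡k+lo : toℕ x ≡ k + lo
    x≡k+lo = toℕ-fromℕ< _
    lo≤x : lo ≤ toℕ x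
    lo≤x = subst (lo ≤_) (sym x≡k+lo) (m≤n+m lo k)
    x<hi : toℕ x < hi
    x<hi = subst (_< hi) (sym x≡k+lo) k+lo<hi
    shifted : toℕ x ∸ lo ≡ k
    shifted = trans (cong (_∸ lo) x≡k+lo) (m+n∸n≡m k lo)

allVectors : (n k : ℕ) → List (Vector (Fin n) k)
allVectors n zero = [ []ᵛ ]
allVectors n (suc k) = cartesianProductWith _∷ᵛ_ (allFin n) (allVectors n k)

allVectors-complete : ∀ {n} k (e : Vector (Fin n) k) → Any (_≗ e) (allVectors n k)
allVectors-complete zero e = here (λ ())
allVectors-complete {n} (suc k) e
  with g , g∈ , g≗tail ← find (allVectors-complete k (e ∘ suc)) =
  lose (∈-cartesianProductWith⁺ _∷ᵛ_ (∈-allFin (e zero)) g∈) λ where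
    zero → refl
    (suc i) → g≗tail i

extension∈⇒InNbhd : ∀ {r n} (H : Hypergraph r n) j f x →
  Any (_≗ updateAt f j (const x)) H → InNbhd H j f x
extension∈⇒InNbhd H j f x = Any.map λ {e} e≗f[j↦x] →
  (λ i i≢j → trans (e≗f[j↦x] i) (updateAt-minimal i j f i≢j)) ,
  trans (e≗f[j↦x] j) (updateAt-updates j f)

module LowVertexConstruction (m n a b : ℕ) where

  Admissible : Pred (Edge (suc m) n) 0ℓ
  Admissible e = toℕ (e zero) < a → ∃[ i ] toℕ (e (suc i)) < b

  admissible? : Decidable Admissible
  admissible? e = (toℕ (e zero) <? a) →-dec anyᶠ? (λ i → toℕ (e (suc i)) <? b)

  admissible-resp-≗ : ∀ {e e′} → e ≗ e′ → Admissible e′ → Admissible e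
  admissible-resp-≗ e≗e′ adm low
    with i , lowᵢ ← adm (subst (λ v → toℕ v < a) (e≗e′ zero) low) =
    i , subst (λ v → toℕ v < b) (sym (e≗e′ (suc i))) lowᵢ

  H : Hypergraph (suc m) n
  H = filter admissible? (allVectors n (suc m))

  admissible⇒∈H : ∀ {e} → Admissible e → Any (_≗ e) H
  admissible⇒∈H {e} adm with g , g∈ , g≗e ← find (allVectors-complete (suc m) e) =
    lose (∈-filter⁺ admissible? g∈ (admissible-resp-≗ g≗e adm)) g≗e

  nbhdSize-zero : a ≤ n → ∀ f → n ∸ a ≤ nbhdSize H zero f
  nbhdSize-zero a≤n f = interval⊆filter⇒∸≤length (inNbhd? H zero f) a≤n ≤-refl
    λ x a≤x _ → extension∈⇒InNbhd H zero f x
      (admissible⇒∈H λ x<a → contradiction x<a (≤⇒≯ a≤x))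

  nbhdSize-suc : b ≤ n → ∀ j f → b ≤ nbhdSize H (suc j) f
  nbhdSize-suc b≤n j f = interval⊆filter⇒∸≤length (inNbhd? H (suc j) f) z≤n b≤n
    λ x _ x<b → extension∈⇒InNbhd H (suc j) f x (admissible⇒∈H λ _ →
      j , subst (λ v → toℕ v < b) (sym (updateAt-updates (suc j) f)) x<b)

  no-shallow-hitting : ∀ t → a ≤ n → b ≤ n → m * b * t < a → ¬ HasShallowHittingSet t H
  no-shallow-hitting t a≤n b≤n mbt<a (M , M⊆H , hitting , shallow) =
    <⇒≱ mbt<a (≤-trans a≤|L| |L|≤mbt)
    where
    HeadLow? : Decidable (λ (e : Edge (suc m) n) → toℕ (e zero) < a)
    HeadLow? e = toℕ (e zero) <? a

    L : List (Edge (suc m) n)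
    L = filter HeadLow? M

    a≤|L| : a ≤ length L
    a≤|L| = covering⇒≤length (λ e → toℕ (e zero)) a L λ k k<a →
      let x = fromℕ< (≤-trans k<a a≤n)
          x≡k = toℕ-fromℕ< (≤-trans k<a a≤n)
          e , e∈M , e₀≡x = find (nonempty-filter⇒Any ((zero , x) ∈ₑ?_) M (hitting (zero , x)))
          e₀≡k = trans (cong toℕ e₀≡x) x≡k
      in lose (∈-filter⁺ HeadLow? e∈M (subst (_< a) (sym e₀≡k) k<a)) e₀≡k

    -- The m b low vertices of parts 1, …, m are encoded as Fin (m * b).
    low-vertex : Fin m × Fin b → Vertex (suc m) n
    low-vertex (i , y) = suc i , inject≤ y b≤n

    MeetsLow : Edge (suc m) n → Fin (m * b) → Set
    MeetsLow e ℓ = low-vertex (remQuot {m} b ℓ) ∈ₑ e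

    meets-low : All (λ e → ∃[ ℓ ] MeetsLow e ℓ) L
    meets-low = All.zipWith (λ {e} → meets {e})
      ( filter⁺ HeadLow? (All-resp-⊆ M⊆H (all-filter admissible? (allVectors n (suc m))))
      , all-filter HeadLow? M)
      where
      meets : ∀ {e} → Admissible e × toℕ (e zero) < a → ∃[ ℓ ] MeetsLow e ℓ
      meets {e} (adm , low) with i , lowᵢ ← adm low =
        combine i y , subst ((_∈ₑ e) ∘ low-vertex) (sym (remQuot-combine i y))
          (toℕ-injective (trans (sym (toℕ-fromℕ< lowᵢ)) (sym (toℕ-inject≤ y b≤n))))
        where y = fromℕ< lowᵢ

    |L|≤mbt : length L ≤ m * b * t
    |L|≤mbt = double-counting {R = MeetsLow} (λ e ℓ → low-vertex (remQuot {m} b ℓ) ∈ₑ? e)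
      t L meets-low λ ℓ →
      ≤-trans (length-mono-≤ (Sublist.filter⁺ _ _ (λ { refl low → low }) (filter-⊆ HeadLow? M)))
              (shallow (low-vertex (remQuot {m} b ℓ)))

m<[1+m/n]*n : ∀ m n → m < suc (m / suc n) * suc n
m<[1+m/n]*n m n = begin-strict
  m                               ≡⟨ m≡m%n+[m/n]*n m (suc n) ⟩
  m % suc n + m / suc n * suc n   <⟨ +-monoˡ-< _ (m%n<n m (suc n)) ⟩
  suc n + m / suc n * suc n       ∎
  where open ≤-Reasoning

m*[1+n]≤o⇒m*n<o : ∀ m n {o} → 0 < o → m * suc n ≤ o → m * n < o
m*[1+n]≤o⇒m*n<o zero n 0<o _ = 0<o
m*[1+n]≤o⇒m*n<o (suc m) n _ le = <-≤-trans (*-monoʳ-< (suc m) (n<1+n n)) le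

-- If c (s + 1) ≤ n then n - c s ≥ c, so (n - c s)(s + 1) ≥ (n - c s) + c s = n.
m*[1+n]≤o⇒o≤[o∸m*n]*[1+n] : ∀ m n {o} → m * suc n ≤ o → o ≤ (o ∸ m * n) * suc n
m*[1+n]≤o⇒o≤[o∸m*n]*[1+n] m n {o} le = begin
  o                    ≡⟨ m∸n+n≡m (m+n≤o⇒n≤o m le′) ⟨
  d + m * n            ≤⟨ +-monoʳ-≤ d (*-monoˡ-≤ n (m+n≤o⇒m≤o∸n m le′)) ⟩
  d + d * n            ≡⟨ *-suc d n ⟨
  d * suc n            ∎
  where
  open ≤-Reasoning
  d = o ∸ m * n
  le′ : m + m * n ≤ o
  le′ = subst (_≤ o) (*-suc m n) le

theorem4p7 : (r t n : ℕ) → 2 ≤ r → 2 ≤ t → 1 ≤ n →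
    Σ (Hypergraph r n) λ H →
      ((j : Fin r) (f : Fin r → Fin n) →
         n ≤ (nbhdSize H j f + 1) * ((r ∸ 1) * t + 1))
      × ¬ HasShallowHittingSet t H
theorem4p7 zero t n () _ _
theorem4p7 (suc m) t n _ _ 1≤n = H , codegree , no-shallow-hitting t a≤n b≤n (n<1+n (m * b * t))
  where
  K = suc (m * t)
  b = n / K
  a = suc (m * b * t)
  open LowVertexConstruction m n a b

  b≤n : b ≤ n
  b≤n = m/n≤m n K
  mbt≡b*mt : m * b * t ≡ b * (m * t)
  mbt≡b*mt = trans (cong (_* t) (*-comm m b)) (*-assoc b m t)
  a≤n : a ≤ n
  a≤n = subst (_< n) (sym mbt≡b*mt) (m*[1+n]≤o⇒m*n<o b (m * t) 1≤n (m/n*n≤m n K))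

  rescale : ∀ N → n ≤ suc N * K → n ≤ (N + 1) * (m * t + 1)
  rescale N = subst₂ (λ u v → n ≤ u * v) (+-comm 1 N) (+-comm 1 (m * t))

  codegree : (j : Fin (suc m)) (f : Fin (suc m) → Fin n) → n ≤ (nbhdSize H j f + 1) * (m * t + 1)
  codegree zero f = rescale (nbhdSize H zero f) (begin
    n                    ≤⟨ m*[1+n]≤o⇒o≤[o∸m*n]*[1+n] b (m * t) (m/n*n≤m n K) ⟩
    (n ∸ b * (m * t)) * K ≡⟨ cong (λ x → (n ∸ x) * K) mbt≡b*mt ⟨
    (n ∸ m * b * t) * K  ≡⟨ cong (_* K) (+-∸-assoc 1 a≤n) ⟩
    suc (n ∸ a) * K      ≤⟨ *-monoˡ-≤ K (s≤s (nbhdSize-zero a≤n f)) ⟩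
    suc (nbhdSize H zero f) * K ∎)
    where open ≤-Reasoning
  codegree (suc j) f = rescale (nbhdSize H (suc j) f)
    (≤-trans (<⇒≤ (m<[1+m/n]*n n (m * t))) (*-monoˡ-≤ K (s≤s (nbhdSize-suc b≤n j f))))
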